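{- For all integers $n\ge 1$ and $k\ge0$, the number of $e\in\mathbf{I}_n(000)$ with exactly $n-k$ distinct entries equals the number of simsun permutations of $\{1,\ldots,n\}$ with exactly $k$ descents.
   Context: An inversion sequence of length $n$ is an integer sequence $e=(e_1,\ldots,e_n)$ with $0 \le e_i < i$ for all $i$; $\mathbf{I}_n$ is the set of these. $\mathbf{I}_n(000)$ is the set of $e\in\mathbf{I}_n$ in which no value occurs three or more times. A descent of a permutation $\pi=\pi_1\cdots\pi_n$ is an index $i$ with $\pi_i>\pi_{i+1}$; a double descent is an index $i$ with $\pi_{i-1}>\pi_i>\pi_{i+1}$. A permutation of $\{1,\ldots,n\}$ is simsun if for every $m\in\{1,\ldots,n\}$, the word obtained by deleting the letters $m+1,\ldots,n$ (keeping the order of the remaining letters) has no double descent. -}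

module Defs where

open import Data.Bool using (Bool; true; false; _∧_; _∨_; not; if_then_else_)
open import Data.Nat using (ℕ; zero; suc; _+_; _<ᵇ_; _≤ᵇ_; _≡ᵇ_)
open import Data.Nat.Properties using (_≟_)
open import Data.List using (List; []; _∷_; length; filterᵇ; deduplicate; upTo; map)
open import Data.Vec using (Vec; toList)
open import Relation.Binary.PropositionalEquality using (_≡_)
open import Data.Product using (Σ; _×_)

all : (ℕ → Bool) → List ℕ → Bool
all p [] = true
all p (x ∷ xs) = p x ∧ all p xs

occ : ℕ → List ℕ → ℕ
occ x [] = 0
occ x (y ∷ ys) = (if x ≡ᵇ y then 1 else 0) + occ x ys

-- invFrom i l : entries of l, occupying positions i+1, i+2, ... (1-based),
-- satisfy e_j < j
invFrom : ℕ → List ℕ → Bool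
invFrom i [] = true
invFrom i (x ∷ xs) = (x <ᵇ suc i) ∧ invFrom (suc i) xs

isInvSeq : ∀ {n} → Vec ℕ n → Bool
isInvSeq e = invFrom 0 (toList e)

-- no value occurs three or more times (pattern 000 avoided)
avoids000 : ∀ {n} → Vec ℕ n → Bool
avoids000 e = all (λ x → occ x (toList e) <ᵇ 3) (toList e)

distinctEntries : ∀ {n} → Vec ℕ n → ℕ
distinctEntries e = length (deduplicate _≟_ (toList e))

isInvSeq000 : ∀ {n} → Vec ℕ n → Bool
isInvSeq000 e = isInvSeq e ∧ avoids000 e

-- Permutations of {1,…,n} in one-line notation (words of length n)

isPerm : ∀ n → Vec ℕ n → Bool
isPerm n w = all (λ x → (1 ≤ᵇ x) ∧ (x ≤ᵇ n) ∧ (occ x (toList w) ≡ᵇ 1)) (toList w)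

desList : List ℕ → ℕ
desList (x ∷ y ∷ r) = (if y <ᵇ x then 1 else 0) + desList (y ∷ r)
desList _ = 0

des : ∀ {n} → Vec ℕ n → ℕ
des w = desList (toList w)

hasDoubleDescent : List ℕ → Bool
hasDoubleDescent (x ∷ y ∷ z ∷ r) = ((y <ᵇ x) ∧ (z <ᵇ y)) ∨ hasDoubleDescent (y ∷ z ∷ r)
hasDoubleDescent _ = false

restrict : ℕ → List ℕ → List ℕ
restrict m w = filterᵇ (λ x → x ≤ᵇ m) w

isSimsun : ∀ n → Vec ℕ n → Bool
isSimsun n w = all (λ m → not (hasDoubleDescent (restrict m (toList w)))) (map suc (upTo n))

isSimsunPerm : ∀ n → Vec ℕ n → Bool
isSimsunPerm n w = isPerm n w ∧ isSimsun n w

-- { e ∈ I_n(000) : e has exactly n − k distinct entries }  (written d + k = n)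
InvSeq000WithDistinct : ℕ → ℕ → Set
InvSeq000WithDistinct n k =
  Σ (Vec ℕ n) (λ e → (isInvSeq000 e ≡ true) × (distinctEntries e + k ≡ n))

SimsunWithDescents : ℕ → ℕ → Set
SimsunWithDescents n k =
  Σ (Vec ℕ n) (λ w → (isSimsunPerm n w ≡ true) × (des w ≡ k))

module Submission where

-- Both families A(n,k) satisfy A(0,k) = [k = 0] and the recursion
--   A(n+1,k) ≅ A(n,k) × Fin (k+1)  ⊎  A(n,k−1) × Fin (n − 2(k−1)),
-- so both are in bijection with the set Code n k defined by this recursion.
--  * Inversion sequences: split off the last entry v ∈ {0, …, n}.  Either v
--    is a value unused by the first n entries (k + 1 choices when these have
--    n − k distinct entries), or v is used exactly once (n − 2(k−1) choices
--    when they have n − (k−1) distinct entries); no other value is allowed.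
--  * Simsun permutations: remove the letter n + 1.  Re-inserting it into a
--    simsun permutation with j descents is allowed exactly at the slots not
--    followed by a descent; j + 1 of them keep the descents and n − 2j add one.

open import Defs
open import Data.Bool using (Bool; true; false; _∧_; _∨_; not; if_then_else_; T; T?)
open import Data.Bool.Properties using (∧-zeroʳ; ∧-identityʳ; ∨-conicalˡ; ∨-conicalʳ)
open import Data.Nat using (ℕ; zero; suc; _+_; _∸_; _*_; _<ᵇ_; _≤ᵇ_; _≡ᵇ_; _<_; _≤_; z≤n; s≤s)
open import Data.Nat.Properties
open import Data.Nat.Tactic.RingSolver using (solve-∀)
open import Data.Fin using (Fin; zero; suc)
open import Data.Fin.Properties using (+↔⊎)
open import Data.List using (List; []; _∷_; _++_; length; filter; filterᵇ; deduplicate; upTo; map; applyUpTo)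
open import Data.List.Properties using (filter-++; map-applyUpTo; length-deduplicate)
open import Data.Maybe using (Maybe; just; nothing)
open import Data.Vec using (Vec; []; _∷_; toList; _∷ʳ_; init; last; initLast; insertAt; removeAt; lookup)
open import Data.Vec.Properties
  using (toList-∷ʳ; length-toList; init-∷ʳ; last-∷ʳ; insertAt-removeAt; removeAt-insertAt)
open import Data.Product using (Σ; _×_; _,_; proj₁; proj₂)
open import Data.Product.Function.Dependent.Propositional using (Σ-↔)
open import Data.Product.Function.NonDependent.Propositional using (_×-↔_)
open import Data.Sum using (_⊎_; inj₁; inj₂)
open import Data.Sum.Function.Propositional using (_⊎-↔_)
open import Data.Empty using (⊥; ⊥-elim)
open import Data.Unit using (⊤; tt)
open import Function.Bundles using (_↔_; _⤖_; _⇔_; mk↔ₛ′; mk⇔; module Equivalence)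
open import Function.Properties.Inverse using (↔-refl; ↔-sym; ↔-trans; ↔⇒⤖)
open import Level using (0ℓ)
open import Relation.Binary.PropositionalEquality
open import Relation.Nullary using (does; ¬?; yes; no)
open import Relation.Nullary.Irrelevant using (Irrelevant)
open import Relation.Unary using (Pred; Decidable)

T⇒true : ∀ {b} → T b → b ≡ true
T⇒true {true} _ = refl

true⇒T : ∀ {b} → b ≡ true → T b
true⇒T refl = tt

∧-intro : ∀ {a b} → a ≡ true → b ≡ true → a ∧ b ≡ true
∧-intro refl refl = refl

∧-l : ∀ {a b} → a ∧ b ≡ true → a ≡ true
∧-l {true} _ = refl

∧-r : ∀ {a b} → a ∧ b ≡ true → b ≡ true
∧-r {true} p = p

not-true : ∀ {b} → not b ≡ true → b ≡ false
not-true {false} _ = refl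

false⇒not : ∀ {b} → b ≡ false → not b ≡ true
false⇒not refl = refl

-- proofs of b ≡ true are unique, so side conditions are proof-irrelevant
true-irrelevant : ∀ {b : Bool} (p q : b ≡ true) → p ≡ q
true-irrelevant refl refl = refl

≡ᵇ-refl : ∀ x → (x ≡ᵇ x) ≡ true
≡ᵇ-refl x = T⇒true (≡⇒≡ᵇ x x refl)

≡ᵇ-sound : ∀ x y → (x ≡ᵇ y) ≡ true → x ≡ y
≡ᵇ-sound x y p = ≡ᵇ⇒≡ x y (true⇒T p)

≡ᵇ-complete : ∀ {x y} → x ≡ y → (x ≡ᵇ y) ≡ true
≡ᵇ-complete {x} refl = ≡ᵇ-refl x

≡ᵇ-false : ∀ x y → (x ≡ᵇ y) ≡ false → x ≢ y
≡ᵇ-false x .x p refl with () ← trans (sym (≡ᵇ-refl x)) p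

≡ᵇ-sym : ∀ x y → (x ≡ᵇ y) ≡ (y ≡ᵇ x)
≡ᵇ-sym zero zero = refl
≡ᵇ-sym zero (suc y) = refl
≡ᵇ-sym (suc x) zero = refl
≡ᵇ-sym (suc x) (suc y) = ≡ᵇ-sym x y

<ᵇ-sound : ∀ m n → (m <ᵇ n) ≡ true → m < n
<ᵇ-sound m n p = <ᵇ⇒< m n (true⇒T p)

<ᵇ-complete : ∀ {m n} → m < n → (m <ᵇ n) ≡ true
<ᵇ-complete p = T⇒true (<⇒<ᵇ p)

<ᵇ-false : ∀ {m n} → n ≤ m → (m <ᵇ n) ≡ false
<ᵇ-false {m} {zero} _ = refl
<ᵇ-false {suc m} {suc n} (s≤s p) = <ᵇ-false p

≤ᵇ-sound : ∀ m n → (m ≤ᵇ n) ≡ true → m ≤ n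
≤ᵇ-sound m n p = ≤ᵇ⇒≤ m n (true⇒T p)

≤ᵇ-complete : ∀ {m n} → m ≤ n → (m ≤ᵇ n) ≡ true
≤ᵇ-complete p = T⇒true (≤⇒≤ᵇ p)

≤ᵇ-false : ∀ {m n} → n < m → (m ≤ᵇ n) ≡ false
≤ᵇ-false {m} {n} n<m with m ≤ᵇ n in eq
... | true = ⊥-elim (<⇒≱ n<m (≤ᵇ-sound m n eq))
... | false = refl

ind : Bool → ℕ
ind b = if b then 1 else 0

_∘↔_ : ∀ {A B C : Set} → A ↔ B → B ↔ C → A ↔ C
_∘↔_ = ↔-trans
infixr 5 _∘↔_

×-irrelevant : ∀ {P Q : Set} → Irrelevant P → Irrelevant Q → Irrelevant (P × Q)
×-irrelevant ip iq (p , q) (p' , q') = cong₂ _,_ (ip p p') (iq q q')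

Σ-≡ : ∀ {X : Set} {P : X → Set} {x x' : X} {p : P x} {p' : P x'} →
      x ≡ x' → Irrelevant (P x') → (x , p) ≡ (x' , p')
Σ-≡ refl irr = cong (_ ,_) (irr _ _)

Fin-cong : ∀ {a b} → a ≡ b → Fin a ↔ Fin b
Fin-cong refl = ↔-refl

Σ-constFibre : ∀ {X : Set} {Y : X → Set} {c} → (∀ x → Y x ↔ Fin c) → Σ X Y ↔ (X × Fin c)
Σ-constFibre h = Σ-↔ ↔-refl (λ {x} → h x)

Σ-reassoc : ∀ {A V : Set} {R : A → Set} {F : A → V → Set} →
  Σ (A × V) (λ (a , v) → R a × F a v) ↔ Σ (Σ A R) (λ (a , _) → Σ V (F a))
Σ-reassoc = mk↔ₛ′ (λ ((a , v) , r , f) → (a , r) , (v , f)) (λ ((a , r) , (v , f)) → (a , v) , r , f)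
                (λ _ → refl) (λ _ → refl)

Σ-transport : ∀ {X X' : Set} {P : X → Set} {Q : X' → Set} (f : X → X') (g : X' → X) →
  (∀ a → P a → Q (f a)) → (∀ a' → Q a' → P (g a')) →
  (∀ a → P a → g (f a) ≡ a) → (∀ a' → Q a' → f (g a') ≡ a') →
  (∀ a → Irrelevant (P a)) → (∀ a' → Irrelevant (Q a')) → Σ X P ↔ Σ X' Q
Σ-transport f g pf qg gf fg ip iq = mk↔ₛ′ (λ (a , p) → f a , pf a p) (λ (a' , q) → g a' , qg a' q)
  (λ (a' , q) → Σ-≡ (fg a' q) (iq a')) (λ (a , p) → Σ-≡ (gf a p) (ip a))

Σ-split : ∀ {X : Set} {P Q₁ Q₂ : X → Set} → (∀ x → P x → Q₁ x ⊎ Q₂ x)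
        → (∀ x → Q₁ x → P x) → (∀ x → Q₂ x → P x) → (∀ x → Q₁ x → Q₂ x → ⊥)
        → (∀ x → Irrelevant (P x)) → (∀ x → Irrelevant (Q₁ x)) → (∀ x → Irrelevant (Q₂ x))
        → Σ X P ↔ (Σ X Q₁ ⊎ Σ X Q₂)
Σ-split {X} {P} {Q₁} {Q₂} split back₁ back₂ disjoint ip i₁ i₂ = mk↔ₛ′ to from to∘from from∘to
  where
  inject : ∀ x → Q₁ x ⊎ Q₂ x → Σ X Q₁ ⊎ Σ X Q₂
  inject x (inj₁ q) = inj₁ (x , q)
  inject x (inj₂ q) = inj₂ (x , q)
  to : Σ X P → Σ X Q₁ ⊎ Σ X Q₂
  to (x , p) = inject x (split x p)
  from : Σ X Q₁ ⊎ Σ X Q₂ → Σ X P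
  from (inj₁ (x , q)) = x , back₁ x q
  from (inj₂ (x , q)) = x , back₂ x q
  to∘from : ∀ y → to (from y) ≡ y
  to∘from (inj₁ (x , q)) with split x (back₁ x q)
  ... | inj₁ _ = cong (λ z → inj₁ (x , z)) (i₁ x _ _)
  ... | inj₂ q' = ⊥-elim (disjoint x q q')
  to∘from (inj₂ (x , q)) with split x (back₂ x q)
  ... | inj₁ q' = ⊥-elim (disjoint x q' q)
  ... | inj₂ _ = cong (λ z → inj₂ (x , z)) (i₂ x _ _)
  from∘to : ∀ y → from (to y) ≡ y
  from∘to (x , p) with split x p
  ... | inj₁ _ = cong (x ,_) (ip x _ _)
  ... | inj₂ _ = cong (x ,_) (ip x _ _)

sumBelow : (ℕ → ℕ) → ℕ → ℕ
sumBelow f zero = 0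
sumBelow f (suc N) = f 0 + sumBelow (λ v → f (suc v)) N

countBelow : (ℕ → Bool) → ℕ → ℕ
countBelow p N = sumBelow (λ v → ind (p v)) N

sumBelow-+ : ∀ f g N → sumBelow (λ v → f v + g v) N ≡ sumBelow f N + sumBelow g N
sumBelow-+ f g zero = refl
sumBelow-+ f g (suc N) rewrite sumBelow-+ (λ v → f (suc v)) (λ v → g (suc v)) N =
  interchange (f 0) (g 0) (sumBelow (λ v → f (suc v)) N) (sumBelow (λ v → g (suc v)) N)
  where
  interchange : ∀ a b c d → a + b + (c + d) ≡ a + c + (b + d)
  interchange = solve-∀

sumBelow-cong : ∀ f g N → (∀ v → f v ≡ g v) → sumBelow f N ≡ sumBelow g N
sumBelow-cong f g zero h = refl
sumBelow-cong f g (suc N) h = cong₂ _+_ (h 0) (sumBelow-cong _ _ N (λ v → h (suc v)))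

sumBelow-mono : ∀ f g N → (∀ v → f v ≤ g v) → sumBelow f N ≤ sumBelow g N
sumBelow-mono f g zero h = z≤n
sumBelow-mono f g (suc N) h = +-mono-≤ (h 0) (sumBelow-mono _ _ N (λ v → h (suc v)))

sumBelow-const : ∀ c N → sumBelow (λ _ → c) N ≡ N * c
sumBelow-const c zero = refl
sumBelow-const c (suc N) = cong (c +_) (sumBelow-const c N)

sumBelow-single : ∀ c x N → x < N → sumBelow (λ v → if v ≡ᵇ x then c else 0) N ≡ c
sumBelow-single c zero (suc N) _ = trans (cong (c +_) (trans (sumBelow-const 0 N) (*-zeroʳ N))) (+-identityʳ c)
sumBelow-single c (suc x) (suc N) (s≤s p) = sumBelow-single c x N p

true↔Fin-ind : ∀ b → (b ≡ true) ↔ Fin (ind b)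
true↔Fin-ind true = mk↔ₛ′ (λ _ → zero) (λ _ → refl) (λ { zero → refl }) (λ { refl → refl })
true↔Fin-ind false = mk↔ₛ′ (λ ()) (λ ()) (λ ()) (λ ())

countBelow↔Fin : ∀ (p : ℕ → Bool) N → Σ ℕ (λ v → (v <ᵇ N) ∧ p v ≡ true) ↔ Fin (countBelow p N)
countBelow↔Fin p zero = mk↔ₛ′ (λ { (_ , ()) }) (λ ()) (λ ()) (λ { (_ , ()) })
countBelow↔Fin p (suc N) =
  peel ∘↔ (true↔Fin-ind (p 0) ⊎-↔ countBelow↔Fin (λ v → p (suc v)) N) ∘↔ ↔-sym +↔⊎
  where
  peel : Σ ℕ (λ v → (v <ᵇ suc N) ∧ p v ≡ true)
       ↔ ((p 0 ≡ true) ⊎ Σ ℕ (λ v → (v <ᵇ N) ∧ p (suc v) ≡ true))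
  peel = mk↔ₛ′ (λ { (zero , q) → inj₁ q ; (suc v , q) → inj₂ (v , q) })
             (λ { (inj₁ q) → zero , q ; (inj₂ (v , q)) → suc v , q })
             (λ { (inj₁ q) → refl ; (inj₂ (v , q)) → refl })
             (λ { (zero , q) → refl ; (suc v , q) → refl })

countFin : ∀ {N} → (Fin N → Bool) → ℕ
countFin {zero} p = 0
countFin {suc N} p = ind (p zero) + countFin (λ i → p (suc i))

countFin↔Fin : ∀ {N} (p : Fin N → Bool) → Σ (Fin N) (λ i → p i ≡ true) ↔ Fin (countFin p)
countFin↔Fin {zero} p = mk↔ₛ′ (λ { (() , _) }) (λ ()) (λ ()) (λ { (() , _) })
countFin↔Fin {suc N} p =
  peel ∘↔ (true↔Fin-ind (p zero) ⊎-↔ countFin↔Fin (λ i → p (suc i))) ∘↔ ↔-sym +↔⊎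
  where
  peel : Σ (Fin (suc N)) (λ i → p i ≡ true) ↔ ((p zero ≡ true) ⊎ Σ (Fin N) (λ i → p (suc i) ≡ true))
  peel = mk↔ₛ′ (λ { (zero , q) → inj₁ q ; (suc i , q) → inj₂ (i , q) })
             (λ { (inj₁ q) → zero , q ; (inj₂ (i , q)) → suc i , q })
             (λ { (inj₁ q) → refl ; (inj₂ (i , q)) → refl })
             (λ { (zero , q) → refl ; (suc i , q) → refl })

countFin-partition : ∀ {N} (p q r : Fin N → Bool) → (∀ i → ind (p i) + ind (q i) + ind (r i) ≡ 1) →
  countFin p + countFin q + countFin r ≡ N
countFin-partition {zero} p q r h = refl
countFin-partition {suc N} p q r h =
  trans (regroup (ind (p zero)) (ind (q zero)) (ind (r zero)) (countFin p') (countFin q') (countFin r'))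
        (cong₂ _+_ (h zero) (countFin-partition p' q' r' (λ i → h (suc i))))
  where
  p' q' r' : Fin N → Bool
  p' i = p (suc i)
  q' i = q (suc i)
  r' i = r (suc i)
  regroup : ∀ a b c x y z → a + x + (b + y) + (c + z) ≡ a + b + c + (x + y + z)
  regroup = solve-∀

AtPred : ℕ → (ℕ → Set) → Set
AtPred zero P = ⊥
AtPred (suc j) P = P j

AtPred-intro : ∀ {k j} {P : ℕ → Set} → k ≡ suc j → P j → AtPred k P
AtPred-intro refl p = p

AtPred-elim : ∀ k {P : ℕ → Set} → AtPred k P → Σ ℕ (λ j → k ≡ suc j × P j)
AtPred-elim (suc j) p = j , refl , p

AtPred-map : ∀ k {P Q : ℕ → Set} → (∀ j → P j → Q j) → AtPred k P → AtPred k Q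
AtPred-map (suc j) f p = f j p

AtPred-irrelevant : ∀ k {P : ℕ → Set} → (∀ j → Irrelevant (P j)) → Irrelevant (AtPred k P)
AtPred-irrelevant (suc j) irr = irr j

Step : ℕ → ℕ → (ℕ → Set) → Set
Step n k A = (A k × Fin (suc k)) ⊎ AtPred k (λ j → A j × Fin (n ∸ (j + j)))

Code : ℕ → ℕ → Set
Code zero zero = ⊤
Code zero (suc k) = ⊥
Code (suc n) k = Step n k (Code n)

Step-cong : ∀ n k {A B : ℕ → Set} → (∀ j → A j ↔ B j) → Step n k A ↔ Step n k B
Step-cong n zero h = (h zero ×-↔ ↔-refl) ⊎-↔ ↔-refl
Step-cong n (suc k) h = (h (suc k) ×-↔ ↔-refl) ⊎-↔ (h k ×-↔ ↔-refl)

↔Code : (A : ℕ → ℕ → Set) → (∀ k → A 0 k ↔ Code 0 k) →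
        (∀ n k → A (suc n) k ↔ Step n k (A n)) → ∀ n k → A n k ↔ Code n k
↔Code A base step zero k = base k
↔Code A base step (suc n) k = step n k ∘↔ Step-cong n k (↔Code A base step n)

-- The two halves of a step, for a family A j = Σ Base (InA j) of bases
-- with a statistic j: extending a base of A(n,k) by one of its k+1 good₁
-- choices, or a base of A(n,k−1) by one of its n − 2(k−1) good₂ choices.
module StepFromFibres (n k : ℕ) {Base Choice : Set} (InA : ℕ → Base → Set)
  (good₁ good₂ : Base → Choice → Set)
  (fibre₁ : ∀ b → InA k b → Σ Choice (good₁ b) ↔ Fin (suc k))
  (fibre₂ : ∀ j b → InA j b → Σ Choice (good₂ b) ↔ Fin (n ∸ (j + j))) where

  Extend₁ Extend₂ : Base × Choice → Set
  Extend₁ (b , c) = InA k b × good₁ b c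
  Extend₂ (b , c) = AtPred k (λ j → InA j b) × good₂ b c

  Step-from-fibres : (Σ (Base × Choice) Extend₁ ⊎ Σ (Base × Choice) Extend₂)
                   ↔ Step n k (λ j → Σ Base (InA j))
  Step-from-fibres = (Σ-reassoc ∘↔ Σ-constFibre (λ (b , a) → fibre₁ b a)) ⊎-↔ lower k refl
    where
    lower : ∀ k' → k ≡ k' →
            Σ (Base × Choice) Extend₂ ↔ AtPred k' (λ j → Σ Base (InA j) × Fin (n ∸ (j + j)))
    lower zero refl = mk↔ₛ′ (λ { (_ , () , _) }) (λ ()) (λ ()) (λ { (_ , () , _) })
    lower (suc j) refl = Σ-reassoc ∘↔ Σ-constFibre (λ (b , a) → fibre₂ j b a)

Occurs : ℕ → List ℕ → Set
Occurs x l = (occ x l ≡ᵇ 0) ≡ false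

occ-++ : ∀ x l m → occ x (l ++ m) ≡ occ x l + occ x m
occ-++ x [] m = refl
occ-++ x (y ∷ l) m =
  trans (cong (ind (x ≡ᵇ y) +_) (occ-++ x l m)) (sym (+-assoc (ind (x ≡ᵇ y)) (occ x l) (occ x m)))

occ-snoc : ∀ x l v → occ x (l ++ v ∷ []) ≡ occ x l + ind (x ≡ᵇ v)
occ-snoc x l v = trans (occ-++ x l (v ∷ [])) (cong (occ x l +_) (+-identityʳ _))

occurs-head : ∀ y l → Occurs y (y ∷ l)
occurs-head y l rewrite ≡ᵇ-refl y = refl

occurs-tail : ∀ x y l → Occurs x l → Occurs x (y ∷ l)
occurs-tail x y l o with x ≡ᵇ y
... | true = refl
... | false = o

Below : ℕ → List ℕ → Set
Below M l = all (λ x → x <ᵇ M) l ≡ true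

occurs : ℕ → List ℕ → Bool
occurs v l = not (occ v l ≡ᵇ 0)

all-elim : ∀ p l x → all p l ≡ true → Occurs x l → p x ≡ true
all-elim p (y ∷ l) x h o with x ≡ᵇ y in eq
... | true rewrite ≡ᵇ-sound x y eq = ∧-l h
... | false = all-elim p l x (∧-r {p y} h) o

all-intro : ∀ p l → (∀ x → Occurs x l → p x ≡ true) → all p l ≡ true
all-intro p [] h = refl
all-intro p (y ∷ l) h = ∧-intro (h y (occurs-head y l)) (all-intro p l (λ x o → h x (occurs-tail x y l o)))

all-mono : ∀ p q l → (∀ x → p x ≡ true → q x ≡ true) → all p l ≡ true → all q l ≡ true
all-mono p q l h a = all-intro q l (λ x o → h x (all-elim p l x a o))

all-++ : ∀ p l m → all p (l ++ m) ≡ all p l ∧ all p m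
all-++ p [] m = refl
all-++ p (y ∷ l) m rewrite all-++ p l m with p y
... | true = refl
... | false = refl

all-left : ∀ p u v → all p (u ++ v) ≡ true → all p u ≡ true
all-left p u v h = ∧-l (trans (sym (all-++ p u v)) h)

all-right : ∀ p u v → all p (u ++ v) ≡ true → all p v ≡ true
all-right p u v h = ∧-r {all p u} (trans (sym (all-++ p u v)) h)

all-insert : ∀ p u M v → all p (u ++ v) ≡ true → p M ≡ true → all p (u ++ M ∷ v) ≡ true
all-insert p u M v h m = trans (all-++ p u (M ∷ v)) (∧-intro (all-left p u v h) (∧-intro m (all-right p u v h)))

filter≡filterᵇ : ∀ {P : Pred ℕ 0ℓ} (P? : Decidable P) l →
  filter P? l ≡ filterᵇ (λ y → does (P? y)) l
filter≡filterᵇ P? [] = refl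
filter≡filterᵇ P? (x ∷ l) with does (P? x)
... | true = cong (x ∷_) (filter≡filterᵇ P? l)
... | false = filter≡filterᵇ P? l

filterᵇ-filterᵇ : ∀ (q r : ℕ → Bool) l → filterᵇ q (filterᵇ r l) ≡ filterᵇ (λ y → q y ∧ r y) l
filterᵇ-filterᵇ q r [] = refl
filterᵇ-filterᵇ q r (y ∷ l) with r y
... | false rewrite ∧-zeroʳ (q y) = filterᵇ-filterᵇ q r l
... | true rewrite ∧-identityʳ (q y) with q y
...   | true = cong (y ∷_) (filterᵇ-filterᵇ q r l)
...   | false = filterᵇ-filterᵇ q r l

filterᵇ-true : ∀ (l : List ℕ) → filterᵇ (λ _ → true) l ≡ l
filterᵇ-true [] = refl
filterᵇ-true (x ∷ l) = cong (x ∷_) (filterᵇ-true l)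

length-filterᵇ-∷ : ∀ (q : ℕ → Bool) x l →
  length (filterᵇ q (x ∷ l)) ≡ ind (q x) + length (filterᵇ q l)
length-filterᵇ-∷ q x l with q x
... | true = refl
... | false = refl

deduplicate-∷ : ∀ x l →
  deduplicate _≟_ (x ∷ l) ≡ x ∷ filterᵇ (λ y → not (x ≡ᵇ y)) (deduplicate _≟_ l)
deduplicate-∷ x l = cong (x ∷_) (filter≡filterᵇ (λ y → ¬? (x ≟ y)) (deduplicate _≟_ l))

deduplicate-count : ∀ q l N → Below N l →
  length (filterᵇ q (deduplicate _≟_ l)) ≡ countBelow (λ v → q v ∧ occurs v l) N
deduplicate-count q [] N h = sym (trans (sumBelow-cong _ _ N (λ v → cong ind (∧-zeroʳ (q v))))
                                        (trans (sumBelow-const 0 N) (*-zeroʳ N)))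
deduplicate-count q (x ∷ l) N h = begin
  length (filterᵇ q (deduplicate _≟_ (x ∷ l)))
    ≡⟨ cong (λ d → length (filterᵇ q d)) (deduplicate-∷ x l) ⟩
  length (filterᵇ q (x ∷ filterᵇ ≢x (deduplicate _≟_ l)))
    ≡⟨ length-filterᵇ-∷ q x (filterᵇ ≢x (deduplicate _≟_ l)) ⟩
  ind (q x) + length (filterᵇ q (filterᵇ ≢x (deduplicate _≟_ l)))
    ≡⟨ cong (λ d → ind (q x) + length d) (filterᵇ-filterᵇ q ≢x (deduplicate _≟_ l)) ⟩
  ind (q x) + length (filterᵇ (λ y → q y ∧ ≢x y) (deduplicate _≟_ l))
    ≡⟨ cong (ind (q x) +_) (deduplicate-count (λ y → q y ∧ ≢x y) l N (∧-r {x <ᵇ N} h)) ⟩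
  ind (q x) + countBelow (λ v → (q v ∧ ≢x v) ∧ occurs v l) N
    ≡⟨ cong (_+ countBelow (λ v → (q v ∧ ≢x v) ∧ occurs v l) N)
            (sym (sumBelow-single (ind (q x)) x N (<ᵇ-sound x N (∧-l h)))) ⟩
  sumBelow (λ v → if v ≡ᵇ x then ind (q x) else 0) N + countBelow (λ v → (q v ∧ ≢x v) ∧ occurs v l) N
    ≡⟨ sym (sumBelow-+ _ _ N) ⟩
  sumBelow (λ v → (if v ≡ᵇ x then ind (q x) else 0) + ind ((q v ∧ ≢x v) ∧ occurs v l)) N
    ≡⟨ sumBelow-cong _ _ N pointwise ⟩
  countBelow (λ v → q v ∧ occurs v (x ∷ l)) N ∎
  where
  open ≡-Reasoning
  ≢x : ℕ → Bool
  ≢x y = not (x ≡ᵇ y)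
  -- v occurs in x ∷ l iff v is x or v ≠ x occurs in l
  pointwise : ∀ v → (if v ≡ᵇ x then ind (q x) else 0) + ind ((q v ∧ ≢x v) ∧ occurs v l)
                  ≡ ind (q v ∧ occurs v (x ∷ l))
  pointwise v with v ≡ᵇ x in eq
  ... | true rewrite ≡ᵇ-sound v x eq | ≡ᵇ-refl x | ∧-zeroʳ (q x) | ∧-identityʳ (q x) = +-identityʳ _
  ... | false rewrite ≡ᵇ-sym x v | eq | ∧-identityʳ (q v) = refl

length-deduplicate-count : ∀ l N → Below N l →
  length (deduplicate _≟_ l) ≡ countBelow (λ v → occurs v l) N
length-deduplicate-count l N h =
  trans (cong length (sym (filterᵇ-true (deduplicate _≟_ l)))) (deduplicate-count (λ _ → true) l N h)

sum-occ : ∀ l N → Below N l → sumBelow (λ v → occ v l) N ≡ length l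
sum-occ [] N h = trans (sumBelow-const 0 N) (*-zeroʳ N)
sum-occ (x ∷ l) N h = trans (sumBelow-+ (λ v → ind (v ≡ᵇ x)) (λ v → occ v l) N)
  (cong₂ _+_ (sumBelow-single 1 x N (<ᵇ-sound x N (∧-l h))) (sum-occ l N (∧-r {x <ᵇ N} h)))

InvSeq000L : List ℕ → Bool
InvSeq000L l = invFrom 0 l ∧ all (λ x → occ x l <ᵇ 3) l

invFrom-bound : ∀ i l → invFrom i l ≡ true → Below (i + length l) l
invFrom-bound i [] p = refl
invFrom-bound i (x ∷ l) p = ∧-intro (<ᵇ-complete (≤-trans (<ᵇ-sound x (suc i) (∧-l p)) i+1≤))
  (all-mono _ _ l (λ y q → <ᵇ-complete (≤-trans (<ᵇ-sound y _ q) (≤-reflexive (sym (+-suc i (length l))))))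
    (invFrom-bound (suc i) l (∧-r {x <ᵇ suc i} p)))
  where
  i+1≤ : suc i ≤ i + length (x ∷ l)
  i+1≤ = ≤-trans (s≤s (m≤m+n i (length l))) (≤-reflexive (sym (+-suc i (length l))))

invFrom-snoc : ∀ i l v → invFrom i (l ++ v ∷ []) ≡ invFrom i l ∧ (v <ᵇ suc (i + length l))
invFrom-snoc i [] v rewrite +-identityʳ i = ∧-identityʳ _
invFrom-snoc i (x ∷ l) v rewrite invFrom-snoc (suc i) l v | +-suc i (length l) with x <ᵇ suc i
... | true = refl
... | false = refl

AtMostTwice : List ℕ → Set
AtMostTwice l = ∀ x → occ x l < 3

atMostTwice-sound : ∀ l → all (λ x → occ x l <ᵇ 3) l ≡ true → AtMostTwice l
atMostTwice-sound l h x with occ x l ≡ᵇ 0 in eq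
... | true rewrite ≡ᵇ-sound (occ x l) 0 eq = s≤s z≤n
... | false = <ᵇ-sound (occ x l) 3 (all-elim (λ x → occ x l <ᵇ 3) l x h eq)

atMostTwice-complete : ∀ l → AtMostTwice l → all (λ x → occ x l <ᵇ 3) l ≡ true
atMostTwice-complete l h = all-intro _ l (λ x _ → <ᵇ-complete (h x))

atMostTwice-snoc⇒ : ∀ l v → AtMostTwice (l ++ v ∷ []) → AtMostTwice l × occ v l < 2
atMostTwice-snoc⇒ l v h = (λ x → ≤-<-trans (m≤m+n (occ x l) _) (subst (_< 3) (occ-snoc x l v) (h x)))
  , ≤-pred (subst (_< 3) (trans (occ-snoc v l v) (trans (cong (λ b → occ v l + ind b) (≡ᵇ-refl v))
                                                           (+-comm (occ v l) 1))) (h v))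

atMostTwice-snoc⇐ : ∀ l v → AtMostTwice l → occ v l < 2 → AtMostTwice (l ++ v ∷ [])
atMostTwice-snoc⇐ l v h o x rewrite occ-snoc x l v with x ≡ᵇ v in eq
... | true rewrite ≡ᵇ-sound x v eq | +-comm (occ v l) 1 = s≤s o
... | false rewrite +-identityʳ (occ x l) = h x

InvSeq000L-bound : ∀ l → InvSeq000L l ≡ true → all (λ x → x <ᵇ suc (length l)) l ≡ true
InvSeq000L-bound l h =
  all-mono _ _ l (λ x q → <ᵇ-complete (m<n⇒m<1+n (<ᵇ-sound x _ q))) (invFrom-bound 0 l (∧-l h))

InvSeq000L-atMostTwice : ∀ l → InvSeq000L l ≡ true → AtMostTwice l
InvSeq000L-atMostTwice l h = atMostTwice-sound l (∧-r {invFrom 0 l} h)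

InvSeq000L-snoc⇒ : ∀ l v → InvSeq000L (l ++ v ∷ []) ≡ true →
  InvSeq000L l ≡ true × (v <ᵇ suc (length l)) ≡ true × occ v l < 2
InvSeq000L-snoc⇒ l v h =
  ∧-intro (∧-l inv) (atMostTwice-complete l (proj₁ twice)) , ∧-r {invFrom 0 l} inv , proj₂ twice
  where
  inv = trans (sym (invFrom-snoc 0 l v)) (∧-l h)
  twice = atMostTwice-snoc⇒ l v (atMostTwice-sound (l ++ v ∷ []) (∧-r {invFrom 0 (l ++ v ∷ [])} h))

InvSeq000L-snoc⇐ : ∀ l v → InvSeq000L l ≡ true → (v <ᵇ suc (length l)) ≡ true → occ v l < 2 →
  InvSeq000L (l ++ v ∷ []) ≡ true
InvSeq000L-snoc⇐ l v h vb o = ∧-intro (trans (invFrom-snoc 0 l v) (∧-intro (∧-l h) vb))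
  (atMostTwice-complete (l ++ v ∷ []) (atMostTwice-snoc⇐ l v (InvSeq000L-atMostTwice l h) o))

module Multiplicities (l : List ℕ) (N : ℕ) (twice : AtMostTwice l) where
  c : ℕ → ℕ
  c j = countBelow (λ v → occ v l ≡ᵇ j) N

  private
    values : ∀ o → o < 3 → ind (o ≡ᵇ 0) + (ind (o ≡ᵇ 1) + ind (o ≡ᵇ 2)) ≡ 1
    values 0 _ = refl
    values 1 _ = refl
    values 2 _ = refl
    values (suc (suc (suc o))) (s≤s (s≤s (s≤s ())))

    weights : ∀ o → o < 3 → ind (o ≡ᵇ 1) + (ind (o ≡ᵇ 2) + ind (o ≡ᵇ 2)) ≡ o
    weights 0 _ = refl
    weights 1 _ = refl
    weights 2 _ = refl
    weights (suc (suc (suc o))) (s≤s (s≤s (s≤s ())))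

    nonzero : ∀ o → o < 3 → ind (not (o ≡ᵇ 0)) ≡ ind (o ≡ᵇ 1) + ind (o ≡ᵇ 2)
    nonzero 0 _ = refl
    nonzero 1 _ = refl
    nonzero 2 _ = refl
    nonzero (suc (suc (suc o))) (s≤s (s≤s (s≤s ())))

  all-values : c 0 + (c 1 + c 2) ≡ N
  all-values = trans (cong (c 0 +_) (sym (sumBelow-+ _ _ N))) (trans (sym (sumBelow-+ _ _ N))
    (trans (sumBelow-cong _ _ N (λ v → values (occ v l) (twice v))) (trans (sumBelow-const 1 N) (*-identityʳ N))))

  all-entries : Below N l → c 1 + (c 2 + c 2) ≡ length l
  all-entries h = trans (cong (c 1 +_) (sym (sumBelow-+ _ _ N))) (trans (sym (sumBelow-+ _ _ N))
    (trans (sumBelow-cong _ _ N (λ v → weights (occ v l) (twice v))) (sum-occ l N h)))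

  distinct-values : countBelow (λ v → occurs v l) N ≡ c 1 + c 2
  distinct-values = trans (sumBelow-cong _ _ N (λ v → nonzero (occ v l) (twice v))) (sumBelow-+ _ _ N)

distinct-snoc : ∀ l v N → v < N →
  countBelow (λ u → occurs u (l ++ v ∷ [])) N ≡ countBelow (λ u → occurs u l) N + ind (occ v l ≡ᵇ 0)
distinct-snoc l v N v<N = trans (sumBelow-cong _ _ N pointwise)
  (trans (sumBelow-+ _ _ N) (cong (countBelow (λ u → occurs u l) N +_) (sumBelow-single _ v N v<N)))
  where
  new : ∀ o → ind (not (o + 1 ≡ᵇ 0)) ≡ ind (not (o ≡ᵇ 0)) + ind (o ≡ᵇ 0)
  new zero = refl
  new (suc o) = refl
  pointwise : ∀ u → ind (occurs u (l ++ v ∷ []))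
                  ≡ ind (occurs u l) + (if u ≡ᵇ v then ind (occ v l ≡ᵇ 0) else 0)
  pointwise u rewrite occ-snoc u l v with u ≡ᵇ v in eq
  ... | true rewrite ≡ᵇ-sound u v eq = new (occ v l)
  ... | false rewrite +-identityʳ (occ u l) = sym (+-identityʳ _)

entries-bound : ∀ {n} (e : Vec ℕ n) → isInvSeq000 e ≡ true → Below (suc n) (toList e)
entries-bound e h = subst (λ m → Below (suc m) (toList e)) (length-toList e) (InvSeq000L-bound (toList e) h)

distinct≤length : ∀ {n} (e : Vec ℕ n) → distinctEntries e ≤ n
distinct≤length e = subst (distinctEntries e ≤_) (length-toList e) (length-deduplicate _≟_ (toList e))

distinct-count : ∀ {n} (e : Vec ℕ n) → isInvSeq000 e ≡ true →
  distinctEntries e ≡ countBelow (λ u → occurs u (toList e)) (suc n)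
distinct-count {n} e h = length-deduplicate-count (toList e) (suc n) (entries-bound e h)

distinct-∷ʳ : ∀ {n} (e : Vec ℕ n) v → isInvSeq000 e ≡ true → v < suc n →
  distinctEntries (e ∷ʳ v) ≡ distinctEntries e + ind (occ v (toList e) ≡ᵇ 0)
distinct-∷ʳ {n} e v h v≤n = begin
  distinctEntries (e ∷ʳ v)
    ≡⟨ cong (λ l → length (deduplicate _≟_ l)) (toList-∷ʳ v e) ⟩
  length (deduplicate _≟_ (toList e ++ v ∷ []))
    ≡⟨ length-deduplicate-count (toList e ++ v ∷ []) (suc n) bound ⟩
  countBelow (λ u → occurs u (toList e ++ v ∷ [])) (suc n)
    ≡⟨ distinct-snoc (toList e) v (suc n) v≤n ⟩
  countBelow (λ u → occurs u (toList e)) (suc n) + ind (occ v (toList e) ≡ᵇ 0)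
    ≡⟨ cong (_+ ind (occ v (toList e) ≡ᵇ 0)) (sym (distinct-count e h)) ⟩
  distinctEntries e + ind (occ v (toList e) ≡ᵇ 0) ∎
  where
  open ≡-Reasoning
  bound : Below (suc n) (toList e ++ v ∷ [])
  bound = trans (all-++ _ (toList e) (v ∷ [])) (∧-intro (entries-bound e h) (∧-intro (<ᵇ-complete v≤n) refl))

-- The defect of e ∈ I_n is k when e has d = n − k distinct entries.
-- Appending a new value keeps the defect: d + 1 + k = n + 1 iff d + k = n.
defect-new : ∀ d k n → (d + 1 + k ≡ suc n) ⇔ (d + k ≡ n)
defect-new d k n = mk⇔ (λ p → suc-injective (trans (cong (_+ k) (+-comm 1 d)) p))
                       (λ p → trans (cong (_+ k) (+-comm d 1)) (cong suc p))

-- Appending a repeated value raises the defect by one (so k ≥ 1, as d ≤ n).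
defect-repeat : ∀ d k n → d ≤ n → (d + 0 + k ≡ suc n) ⇔ AtPred k (λ j → d + j ≡ n)
defect-repeat d k n d≤n = mk⇔ (to k) (from k)
  where
  to : ∀ k → d + 0 + k ≡ suc n → AtPred k (λ j → d + j ≡ n)
  to zero p =
    <-irrefl refl (≤-trans (s≤s d≤n) (≤-reflexive (trans (sym p) (trans (+-identityʳ _) (+-identityʳ d)))))
  to (suc j) p = suc-injective (trans (sym (+-suc d j)) (trans (cong (_+ suc j) (sym (+-identityʳ d))) p))
  from : ∀ k → AtPred k (λ j → d + j ≡ n) → d + 0 + k ≡ suc n
  from (suc j) p = trans (cong (_+ suc j) (+-identityʳ d)) (trans (+-suc d j) (cong suc p))

-- Inversion sequences satisfy the recursion: remove the last entry.

module InvSeqStep (n k : ℕ) where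
  InA : ℕ → Vec ℕ n → Set
  InA j e = (isInvSeq000 e ≡ true) × (distinctEntries e + j ≡ n)

  new once : Vec ℕ n → ℕ → Set
  new e v = (v <ᵇ suc n) ∧ (occ v (toList e) ≡ᵇ 0) ≡ true
  once e v = (v <ᵇ suc n) ∧ (occ v (toList e) ≡ᵇ 1) ≡ true

  InA-irrelevant : ∀ j e → Irrelevant (InA j e)
  InA-irrelevant j e = ×-irrelevant true-irrelevant ≡-irrelevant

  fibre-new : ∀ e → InA k e → Σ ℕ (new e) ↔ Fin (suc k)
  fibre-new e (inv , dk) = countBelow↔Fin _ (suc n) ∘↔ Fin-cong unused
    where
    open Multiplicities (toList e) (suc n) (InvSeq000L-atMostTwice (toList e) inv)
    used : c 1 + c 2 ≡ distinctEntries e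
    used = sym (trans (distinct-count e inv) distinct-values)
    unused : c 0 ≡ suc k
    unused = +-cancelʳ-≡ (c 1 + c 2) (c 0) (suc k) (trans all-values
      (cong suc (trans (sym dk) (trans (cong (_+ k) (sym used)) (+-comm (c 1 + c 2) k)))))

  fibre-once : ∀ j e → InA j e → Σ ℕ (once e) ↔ Fin (n ∸ (j + j))
  fibre-once j e (inv , dj) = countBelow↔Fin _ (suc n) ∘↔ Fin-cong singles
    where
    open Multiplicities (toList e) (suc n) (InvSeq000L-atMostTwice (toList e) inv)
    entries : c 1 + (c 2 + c 2) ≡ n
    entries = trans (all-entries (entries-bound e inv)) (length-toList e)
    doubles : c 2 ≡ j
    doubles = +-cancelˡ-≡ (c 1 + c 2) (c 2) j (begin
      c 1 + c 2 + c 2     ≡⟨ +-assoc (c 1) (c 2) (c 2) ⟩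
      c 1 + (c 2 + c 2)   ≡⟨ trans entries (sym dj) ⟩
      distinctEntries e + j ≡⟨ cong (_+ j) (trans (distinct-count e inv) distinct-values) ⟩
      c 1 + c 2 + j ∎)
      where open ≡-Reasoning
    singles : c 1 ≡ n ∸ (j + j)
    singles = trans (sym (m+n∸n≡m (c 1) (j + j)))
      (cong (_∸ (j + j)) (trans (cong (c 1 +_) (sym (cong₂ _+_ doubles doubles))) entries))

  open StepFromFibres n k InA new once fibre-new fibre-once

  Extends : Vec ℕ n × ℕ → Set
  Extends (e , v) = (isInvSeq000 (e ∷ʳ v) ≡ true) × (distinctEntries (e ∷ʳ v) + k ≡ suc n)

  Unpacked : Vec ℕ n → ℕ → Set
  Unpacked e v = (isInvSeq000 e ≡ true) × ((v <ᵇ suc n) ≡ true) × (occ v (toList e) < 2)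
               × (distinctEntries e + ind (occ v (toList e) ≡ᵇ 0) + k ≡ suc n)

  unpack : ∀ e v → Extends (e , v) → Unpacked e v
  unpack e v (inv , dk) =
    inv' , v≤n , o<2 , trans (cong (_+ k) (sym (distinct-∷ʳ e v inv' (<ᵇ-sound v (suc n) v≤n)))) dk
    where
    snoc = InvSeq000L-snoc⇒ (toList e) v (subst (λ l → InvSeq000L l ≡ true) (toList-∷ʳ v e) inv)
    inv' = proj₁ snoc
    v≤n = subst (λ m → (v <ᵇ suc m) ≡ true) (length-toList e) (proj₁ (proj₂ snoc))
    o<2 = proj₂ (proj₂ snoc)

  pack : ∀ e v → Unpacked e v → Extends (e , v)
  pack e v (inv , v≤n , o<2 , dk) =
      subst (λ l → InvSeq000L l ≡ true) (sym (toList-∷ʳ v e))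
        (InvSeq000L-snoc⇐ (toList e) v inv
          (subst (λ m → (v <ᵇ suc m) ≡ true) (sym (length-toList e)) v≤n) o<2)
    , trans (cong (_+ k) (distinct-∷ʳ e v inv (<ᵇ-sound v (suc n) v≤n))) dk

  classify : ∀ x → Extends x → Extend₁ x ⊎ Extend₂ x
  classify (e , v) ext = by-multiplicity (occ v (toList e)) refl
    where
    d = distinctEntries e
    by-multiplicity : ∀ o → occ v (toList e) ≡ o → Extend₁ (e , v) ⊎ Extend₂ (e , v)
    by-multiplicity o o≡ with unpack e v ext
    by-multiplicity 0 o≡ | inv , v≤n , _ , dk =
      inj₁ ((inv , Equivalence.to (defect-new d k n) (subst (λ o → d + ind (o ≡ᵇ 0) + k ≡ suc n) o≡ dk))
           , ∧-intro v≤n (cong (_≡ᵇ 0) o≡))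
    by-multiplicity 1 o≡ | inv , v≤n , _ , dk =
      inj₂ ( AtPred-map k (λ _ dj → inv , dj)
               (Equivalence.to (defect-repeat d k n (distinct≤length e))
                  (subst (λ o → d + ind (o ≡ᵇ 0) + k ≡ suc n) o≡ dk))
           , ∧-intro v≤n (cong (_≡ᵇ 1) o≡))
    by-multiplicity (suc (suc o)) o≡ | _ , _ , o<2 , _ with s≤s (s≤s ()) ← subst (_< 2) o≡ o<2

  from-new : ∀ x → Extend₁ x → Extends x
  from-new (e , v) ((inv , dk) , nw) = pack e v (inv , ∧-l nw , subst (_< 2) (sym unused) (s≤s z≤n)
    , subst (λ b → distinctEntries e + ind b + k ≡ suc n) (sym (∧-r {v <ᵇ suc n} nw))
            (Equivalence.from (defect-new (distinctEntries e) k n) dk))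
    where
    unused : occ v (toList e) ≡ 0
    unused = ≡ᵇ-sound _ 0 (∧-r {v <ᵇ suc n} nw)

  from-once : ∀ x → Extend₂ x → Extends x
  from-once (e , v) (below , on) = pack e v (inv , ∧-l on , subst (_< 2) (sym used-once) (s≤s (s≤s z≤n))
    , subst (λ b → distinctEntries e + ind b + k ≡ suc n) (sym (cong (_≡ᵇ 0) used-once))
            (Equivalence.from (defect-repeat (distinctEntries e) k n (distinct≤length e))
                              (AtPred-map k (λ _ → proj₂) below)))
    where
    used-once : occ v (toList e) ≡ 1
    used-once = ≡ᵇ-sound _ 1 (∧-r {v <ᵇ suc n} on)
    inv : isInvSeq000 e ≡ true
    inv = proj₁ (proj₂ (proj₂ (AtPred-elim k below)))

  disjoint : ∀ x → Extend₁ x → Extend₂ x → ⊥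
  disjoint (e , v) (_ , nw) (_ , on) =
    0≢1+n (trans (sym (≡ᵇ-sound (occ v (toList e)) 0 (∧-r {v <ᵇ suc n} nw)))
                 (≡ᵇ-sound (occ v (toList e)) 1 (∧-r {v <ᵇ suc n} on)))

  split-last : InvSeq000WithDistinct (suc n) k ↔ Σ (Vec ℕ n × ℕ) Extends
  split-last = Σ-transport (λ w → init w , last w) (λ (e , v) → e ∷ʳ v)
    (λ w p → subst Extends' (sym (init-last w)) p) (λ _ q → q)
    (λ w _ → init-last w) (λ (e , v) _ → cong₂ _,_ (init-∷ʳ v e) (last-∷ʳ v e))
    (λ _ → ×-irrelevant true-irrelevant ≡-irrelevant) (λ _ → ×-irrelevant true-irrelevant ≡-irrelevant)
    where
    Extends' : Vec ℕ (suc n) → Set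
    Extends' w = (isInvSeq000 w ≡ true) × (distinctEntries w + k ≡ suc n)
    init-last : ∀ w → init w ∷ʳ last w ≡ w
    init-last w with initLast w
    ... | _ , _ , refl = refl

  step : InvSeq000WithDistinct (suc n) k ↔ Step n k (InvSeq000WithDistinct n)
  step = split-last
    ∘↔ Σ-split classify from-new from-once disjoint
         (λ _ → ×-irrelevant true-irrelevant ≡-irrelevant)
         (λ (e , _) → ×-irrelevant (InA-irrelevant k e) true-irrelevant)
         (λ (e , _) → ×-irrelevant (AtPred-irrelevant k (λ j → InA-irrelevant j e)) true-irrelevant)
    ∘↔ Step-from-fibres

InvSeq000-base : ∀ k → InvSeq000WithDistinct 0 k ↔ Code 0 k
InvSeq000-base zero =
  mk↔ₛ′ (λ _ → tt) (λ _ → [] , refl , refl) (λ _ → refl) (λ { ([] , refl , refl) → refl })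
InvSeq000-base (suc k) = mk↔ₛ′ (λ { ([] , _ , ()) }) (λ ()) (λ ()) (λ { ([] , _ , ()) })

InvSeq000↔Code : ∀ n k → InvSeq000WithDistinct n k ↔ Code n k
InvSeq000↔Code = ↔Code InvSeq000WithDistinct InvSeq000-base InvSeqStep.step

-- Descents and double descents of words.  A word is read as a letter a
-- (absent at the start) followed by a list; descentInto a v tests whether
-- there is a descent from a into v.

startsWithDescent : List ℕ → Bool
startsWithDescent (b ∷ c ∷ _) = c <ᵇ b
startsWithDescent _ = false

descentInto : Maybe ℕ → List ℕ → Bool
descentInto (just a) (b ∷ _) = b <ᵇ a
descentInto _ _ = false

nonEmpty : List ℕ → Bool
nonEmpty [] = false
nonEmpty (_ ∷ _) = true

lastOf : Maybe ℕ → List ℕ → Maybe ℕ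
lastOf a [] = a
lastOf a (y ∷ u) = lastOf (just y) u

prepend : Maybe ℕ → List ℕ → List ℕ
prepend nothing l = l
prepend (just a) l = a ∷ l

desAfter : Maybe ℕ → List ℕ → ℕ
desAfter a v = ind (descentInto a v) + desList v

desList-∷ : ∀ y v → desList (y ∷ v) ≡ desAfter (just y) v
desList-∷ y [] = refl
desList-∷ y (c ∷ r) = refl

startsWithDescent-∷ : ∀ y v → startsWithDescent (y ∷ v) ≡ descentInto (just y) v
startsWithDescent-∷ y [] = refl
startsWithDescent-∷ y (c ∷ r) = refl

hasDoubleDescent-∷ : ∀ x v →
  hasDoubleDescent (x ∷ v) ≡ (descentInto (just x) v ∧ startsWithDescent v) ∨ hasDoubleDescent v
hasDoubleDescent-∷ x [] = refl
hasDoubleDescent-∷ x (y ∷ []) = sym (cong (_∨ false) (∧-zeroʳ (y <ᵇ x)))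
hasDoubleDescent-∷ x (y ∷ z ∷ r) = refl

NoDoubleDescent : List ℕ → Set
NoDoubleDescent l = hasDoubleDescent l ≡ false

desAfter-++ : ∀ a u v → desAfter a (u ++ v) ≡ desAfter a u + desAfter (lastOf a u) v
desAfter-++ a [] v = sym (cong (λ b → ind b + 0 + desAfter a v) (descentInto-[] a))
  where
  descentInto-[] : ∀ a → descentInto a [] ≡ false
  descentInto-[] nothing = refl
  descentInto-[] (just a) = refl
desAfter-++ a (y ∷ u) v = begin
  ind (descentInto a (y ∷ u ++ v)) + desList (y ∷ u ++ v)
    ≡⟨ cong₂ _+_ (cong ind (descentInto-head a)) (desList-∷ y (u ++ v)) ⟩
  ind (descentInto a (y ∷ u)) + desAfter (just y) (u ++ v)
    ≡⟨ cong (ind (descentInto a (y ∷ u)) +_) (desAfter-++ (just y) u v) ⟩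
  ind (descentInto a (y ∷ u)) + (desAfter (just y) u + desAfter (lastOf (just y) u) v)
    ≡⟨ sym (+-assoc (ind (descentInto a (y ∷ u))) _ _) ⟩
  ind (descentInto a (y ∷ u)) + desAfter (just y) u + desAfter (lastOf (just y) u) v
    ≡⟨ cong (λ m → ind (descentInto a (y ∷ u)) + m + desAfter (lastOf (just y) u) v)
            (sym (desList-∷ y u)) ⟩
  desAfter a (y ∷ u) + desAfter (lastOf a (y ∷ u)) v ∎
  where
  open ≡-Reasoning
  descentInto-head : ∀ a → descentInto a (y ∷ u ++ v) ≡ descentInto a (y ∷ u)
  descentInto-head nothing = refl
  descentInto-head (just a) = refl

MaybeBelow : ℕ → Maybe ℕ → Set
MaybeBelow M nothing = ⊤
MaybeBelow M (just a) = a < M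

lastOf-below : ∀ M a u → MaybeBelow M a → Below M u → MaybeBelow M (lastOf a u)
lastOf-below M a [] a<M _ = a<M
lastOf-below M a (y ∷ u) _ b = lastOf-below M (just y) u (<ᵇ-sound y M (∧-l b)) (∧-r {y <ᵇ M} b)

-- M creates no descent into it and a descent out of it iff v is non-empty
desList-insertMax : ∀ M u v → Below M u → Below M v →
  desList (u ++ M ∷ v) ≡ desAfter nothing u + (ind (nonEmpty v) + desList v)
desList-insertMax M u v bu bv = trans (desAfter-++ nothing u (M ∷ v)) (cong (desAfter nothing u +_)
  (cong₂ _+_ (cong ind (no-descent-into-M (lastOf nothing u) (lastOf-below M nothing u tt bu)))
             (trans (desList-∷ M v) (cong (λ b → ind b + desList v) (descent-out-of-M v bv)))))
  where
  no-descent-into-M : ∀ a → MaybeBelow M a → descentInto a (M ∷ v) ≡ false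
  no-descent-into-M nothing _ = refl
  no-descent-into-M (just a) a<M = <ᵇ-false (<⇒≤ a<M)
  descent-out-of-M : ∀ v → Below M v → descentInto (just M) v ≡ nonEmpty v
  descent-out-of-M [] _ = refl
  descent-out-of-M (y ∷ v) b = ∧-l b

hasDoubleDescent-suffix : ∀ u v → NoDoubleDescent (u ++ v) → NoDoubleDescent v
hasDoubleDescent-suffix [] v h = h
hasDoubleDescent-suffix (a ∷ u) v h =
  hasDoubleDescent-suffix u v (∨-conicalʳ _ _ (trans (sym (hasDoubleDescent-∷ a (u ++ v))) h))

insertMax-no-dd⇒ : ∀ u M v → Below M v → NoDoubleDescent (u ++ M ∷ v) →
  startsWithDescent v ≡ false
insertMax-no-dd⇒ u M [] b h = refl
insertMax-no-dd⇒ u M (x ∷ []) b h = refl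
insertMax-no-dd⇒ u M (x ∷ y ∷ r) b h =
  subst (λ t → (t ∧ (y <ᵇ x)) ≡ false) (∧-l {x <ᵇ M} b)
        (∨-conicalˡ _ _ (hasDoubleDescent-suffix u (M ∷ x ∷ y ∷ r) h))

insertMax-no-dd⇐ : ∀ u M v → Below M u → NoDoubleDescent (u ++ v) → startsWithDescent v ≡ false →
  NoDoubleDescent (u ++ M ∷ v)
insertMax-no-dd⇐ [] M v b h s =
  trans (hasDoubleDescent-∷ M v) (cong₂ _∨_ (trans (cong (descentInto (just M) v ∧_) s) (∧-zeroʳ _)) h)
insertMax-no-dd⇐ (a ∷ u) M v b h s = trans (hasDoubleDescent-∷ a (u ++ M ∷ v))
   (cong₂ _∨_ (at-a u (<ᵇ-sound a M (∧-l b)) (∧-r {a <ᵇ M} b) (∨-conicalˡ _ _ h'))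
              (insertMax-no-dd⇐ u M v (∧-r {a <ᵇ M} b) (∨-conicalʳ _ _ h') s))
  where
  h' = trans (sym (hasDoubleDescent-∷ a (u ++ v))) h
  -- no double descent starts at a: its successor is M or lies in u
  at-a : ∀ u → a < M → Below M u → (descentInto (just a) (u ++ v) ∧ startsWithDescent (u ++ v)) ≡ false →
         (descentInto (just a) (u ++ M ∷ v) ∧ startsWithDescent (u ++ M ∷ v)) ≡ false
  at-a [] a<M _ _ rewrite <ᵇ-false {M} {a} (<⇒≤ a<M) = refl
  at-a (b' ∷ []) _ bu _ rewrite <ᵇ-false {M} {b'} (<⇒≤ (<ᵇ-sound b' M (∧-l bu))) = ∧-zeroʳ _
  at-a (b' ∷ c ∷ r) _ _ t = t

-- Slots.  The slots of a word w of length n are the n + 1 positions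
-- i : Fin (n + 1) at which insertAt w i puts a new letter, between
-- prefix w i and suffix w i.

prefix : ∀ {n} → Vec ℕ n → Fin (suc n) → List ℕ
prefix w zero = []
prefix (y ∷ w) (suc i) = y ∷ prefix w i

suffix : ∀ {n} → Vec ℕ n → Fin (suc n) → List ℕ
suffix w zero = toList w
suffix (y ∷ w) (suc i) = suffix w i

insertAt-split : ∀ {n} (w : Vec ℕ n) i x → toList (insertAt w i x) ≡ prefix w i ++ x ∷ suffix w i
insertAt-split w zero x = refl
insertAt-split (y ∷ w) (suc i) x = cong (y ∷_) (insertAt-split w i x)

prefix-suffix : ∀ {n} (w : Vec ℕ n) i → prefix w i ++ suffix w i ≡ toList w
prefix-suffix w zero = refl
prefix-suffix (y ∷ w) (suc i) = cong (y ∷_) (prefix-suffix w i)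

-- Inserting a maximal letter at a slot before a letter b, after a letter a:
-- if b starts a descent the slot is forbidden (a double descent appears);
-- otherwise it keeps the number of descents when the slot is at the end or
-- a > b, and adds one descent when a < b or the slot is at the start.
keepsDescents addsDescent : Maybe ℕ → List ℕ → Bool
keepsDescents a v = not (startsWithDescent v) ∧ (not (nonEmpty v) ∨ descentInto a v)
addsDescent a v = not (startsWithDescent v) ∧ (nonEmpty v ∧ not (descentInto a v))

descentInto⇒nonEmpty : ∀ a v → descentInto a v ≡ true → nonEmpty v ≡ true
descentInto⇒nonEmpty (just a) (y ∷ v) _ = refl

slot-allowed : ∀ a v → startsWithDescent v ≡ false → keepsDescents a v ≡ true ⊎ addsDescent a v ≡ true
slot-allowed a v s rewrite s with nonEmpty v | descentInto a v
... | false | _ = inj₁ refl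
... | true | true = inj₁ refl
... | true | false = inj₂ refl

slot-kinds-disjoint : ∀ a v → keepsDescents a v ≡ true → addsDescent a v ≡ true → ⊥
slot-kinds-disjoint a v = exclusive (startsWithDescent v) (nonEmpty v) (descentInto a v)
  where
  exclusive : ∀ s e g → (not s ∧ (not e ∨ g)) ≡ true → (not s ∧ (e ∧ not g)) ≡ true → ⊥
  exclusive false true false () _
  exclusive false false g _ ()
  exclusive false true true _ ()

slot-kinds : ∀ s e g → ind (not s ∧ (not e ∨ g)) + ind (not s ∧ (e ∧ not g)) + ind s ≡ 1
slot-kinds true e g = refl
slot-kinds false false false = refl
slot-kinds false false true = refl
slot-kinds false true false = refl
slot-kinds false true true = refl

count-forbidden : ∀ {n} (w : Vec ℕ n) → countFin (λ i → startsWithDescent (suffix w i)) ≡ desList (toList w)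
count-forbidden [] = refl
count-forbidden (y ∷ w) = trans (cong₂ _+_ (cong ind (startsWithDescent-∷ y (toList w))) (count-forbidden w))
                                (sym (desList-∷ y (toList w)))

-- in a word a ∷ w without double descent, the slots of w keeping the
-- descents are the last one and one per descent
count-keeping : ∀ {n} a (w : Vec ℕ n) → NoDoubleDescent (prepend a (toList w)) →
  countFin (λ i → keepsDescents (lastOf a (prefix w i)) (suffix w i)) ≡ suc (desAfter a (toList w))
count-keeping a [] h = cong (λ b → suc (ind b + 0)) (sym (no-descent a))
  where
  no-descent : ∀ a → descentInto a [] ≡ false
  no-descent nothing = refl
  no-descent (just a) = refl
count-keeping a (y ∷ w) h = begin
  ind (keepsDescents a (y ∷ toList w)) + countFin (λ i → keepsDescents (lastOf (just y) (prefix w i)) (suffix w i))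
    ≡⟨ cong₂ _+_ (first-slot (startsWithDescent (y ∷ toList w)) (descentInto a (y ∷ toList w)) (no-dd-at a h))
                 (count-keeping (just y) w (no-dd-after a h)) ⟩
  ind (descentInto a (y ∷ toList w)) + suc (desAfter (just y) (toList w))
    ≡⟨ +-suc _ _ ⟩
  suc (ind (descentInto a (y ∷ toList w)) + desAfter (just y) (toList w))
    ≡⟨ cong (λ m → suc (ind (descentInto a (y ∷ toList w)) + m)) (sym (desList-∷ y (toList w))) ⟩
  suc (desAfter a (y ∷ toList w)) ∎
  where
  open ≡-Reasoning
  -- before y the slot keeps descents iff a > y, as no double descent starts at a
  first-slot : ∀ s g → (g ∧ s) ≡ false → ind (not s ∧ (false ∨ g)) ≡ ind g
  first-slot true false _ = refl
  first-slot false g _ = refl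
  no-dd-at : ∀ a → NoDoubleDescent (prepend a (y ∷ toList w)) →
             (descentInto a (y ∷ toList w) ∧ startsWithDescent (y ∷ toList w)) ≡ false
  no-dd-at nothing _ = refl
  no-dd-at (just x) h = ∨-conicalˡ _ _ (trans (sym (hasDoubleDescent-∷ x (y ∷ toList w))) h)
  no-dd-after : ∀ a → NoDoubleDescent (prepend a (y ∷ toList w)) → NoDoubleDescent (y ∷ toList w)
  no-dd-after nothing h = h
  no-dd-after (just x) h = ∨-conicalʳ _ _ (trans (sym (hasDoubleDescent-∷ x (y ∷ toList w))) h)

IsPermLetter : ℕ → List ℕ → ℕ → Bool
IsPermLetter N l x = (1 ≤ᵇ x) ∧ (x ≤ᵇ N) ∧ (occ x l ≡ᵇ 1)

PermTest : ℕ → List ℕ → Bool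
PermTest N l = all (IsPermLetter N l) l

Perm : ℕ → List ℕ → Set
Perm N l = ∀ x → Occurs x l → (1 ≤ x) × (x ≤ N) × (occ x l ≡ 1)

perm-sound : ∀ N l → PermTest N l ≡ true → Perm N l
perm-sound N l h x o = ≤ᵇ-sound 1 x (∧-l letter) , ≤ᵇ-sound x N (∧-l (∧-r {1 ≤ᵇ x} letter))
                     , ≡ᵇ-sound _ 1 (∧-r {x ≤ᵇ N} (∧-r {1 ≤ᵇ x} letter))
  where letter = all-elim _ l x h o

perm-complete : ∀ N l → Perm N l → PermTest N l ≡ true
perm-complete N l h = all-intro _ l (λ x o → let (1≤x , x≤N , once) = h x o in
  ∧-intro (≤ᵇ-complete 1≤x) (∧-intro (≤ᵇ-complete x≤N) (≡ᵇ-complete once)))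

occ-insert : ∀ x u M v → occ x (u ++ M ∷ v) ≡ occ x (u ++ v) + ind (x ≡ᵇ M)
occ-insert x u M v rewrite occ-++ x u (M ∷ v) | occ-++ x u v = swap (occ x u) (ind (x ≡ᵇ M)) (occ x v)
  where
  swap : ∀ a b c → a + (b + c) ≡ a + c + b
  swap = solve-∀

occ-insert-case : ∀ {b} x u M v → (x ≡ᵇ M) ≡ b → occ x (u ++ M ∷ v) ≡ occ x (u ++ v) + ind b
occ-insert-case x u M v refl = occ-insert x u M v

occurs-insert : ∀ x u M v → Occurs x (u ++ v) → Occurs x (u ++ M ∷ v)
occurs-insert x u M v o rewrite occ-insert x u M v with occ x (u ++ v) | o
... | suc _ | _ = refl

perm-insertMax⇒ : ∀ n u v → Perm (suc n) (u ++ suc n ∷ v) → Perm n (u ++ v)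
perm-insertMax⇒ n u v h x o with h x (occurs-insert x u (suc n) v o) | x ≡ᵇ suc n in eq
... | _ , _ , once | true =
  ⊥-elim (≡ᵇ-false _ 0 o (+-cancelʳ-≡ 1 _ 0 (trans (sym (occ-insert-case x u (suc n) v eq)) once)))
... | 1≤x , x≤n+1 , once | false = 1≤x , ≤-pred (≤∧≢⇒< x≤n+1 (≡ᵇ-false x (suc n) eq))
  , trans (sym (+-identityʳ _)) (trans (sym (occ-insert-case x u (suc n) v eq)) once)

perm-insertMax⇐ : ∀ n u v → Perm n (u ++ v) → Perm (suc n) (u ++ suc n ∷ v)
perm-insertMax⇐ n u v h x o with x ≡ᵇ suc n in eq
... | true rewrite ≡ᵇ-sound x (suc n) eq =
  s≤s z≤n , ≤-refl , trans (occ-insert (suc n) u (suc n) v) (cong₂ _+_ max-absent (cong ind (≡ᵇ-refl n)))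
  where
  max-absent : occ (suc n) (u ++ v) ≡ 0
  max-absent with occ (suc n) (u ++ v) ≡ᵇ 0 in occurs
  ... | true = ≡ᵇ-sound _ 0 occurs
  ... | false = ⊥-elim (<-irrefl refl (proj₁ (proj₂ (h (suc n) occurs))))
... | false = 1≤x , m≤n⇒m≤1+n x≤n , trans same once
  where
  same : occ x (u ++ suc n ∷ v) ≡ occ x (u ++ v)
  same = trans (occ-insert-case x u (suc n) v eq) (+-identityʳ _)
  letter = h x (subst (λ m → (m ≡ᵇ 0) ≡ false) same o)
  1≤x = proj₁ letter
  x≤n = proj₁ (proj₂ letter)
  once = proj₂ (proj₂ letter)

perm-bound : ∀ n l → Perm n l → all (λ x → x ≤ᵇ n) l ≡ true
perm-bound n l h = all-intro _ l (λ x o → ≤ᵇ-complete (proj₁ (proj₂ (h x o))))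

perm-below : ∀ n l → Perm n l → Below (suc n) l
perm-below n l h = all-intro _ l (λ x o → <ᵇ-complete (s≤s (proj₁ (proj₂ (h x o)))))

insert-bound : ∀ n u v → Perm n (u ++ v) → all (λ x → x ≤ᵇ suc n) (u ++ suc n ∷ v) ≡ true
insert-bound n u v p = all-insert _ u (suc n) v
  (all-mono _ _ (u ++ v) (λ x x≤n → ≤ᵇ-complete (m≤n⇒m≤1+n (≤ᵇ-sound x n x≤n)))
              (perm-bound n (u ++ v) p))
  (≤ᵇ-complete {suc n} ≤-refl)

SimsunTest : ℕ → List ℕ → Bool
SimsunTest N l = all (λ m → not (hasDoubleDescent (restrict m l))) (map suc (upTo N))

Simsun : ℕ → List ℕ → Set
Simsun N l = ∀ m → m < N → NoDoubleDescent (restrict (suc m) l)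

all-applyUpTo⇒ : ∀ p (f : ℕ → ℕ) N → all p (applyUpTo f N) ≡ true → ∀ m → m < N → p (f m) ≡ true
all-applyUpTo⇒ p f (suc N) h zero _ = ∧-l h
all-applyUpTo⇒ p f (suc N) h (suc m) (s≤s m<N) = all-applyUpTo⇒ p (λ m → f (suc m)) N (∧-r {p (f 0)} h) m m<N

all-applyUpTo⇐ : ∀ p (f : ℕ → ℕ) N → (∀ m → m < N → p (f m) ≡ true) →
  all p (applyUpTo f N) ≡ true
all-applyUpTo⇐ p f zero h = refl
all-applyUpTo⇐ p f (suc N) h =
  ∧-intro (h 0 (s≤s z≤n)) (all-applyUpTo⇐ p (λ m → f (suc m)) N (λ m m<N → h (suc m) (s≤s m<N)))

simsun-sound : ∀ N l → SimsunTest N l ≡ true → Simsun N l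
simsun-sound N l h m m<N =
  not-true (all-applyUpTo⇒ _ suc N (subst (λ ms → all _ ms ≡ true) (map-applyUpTo (λ x → x) suc N) h) m m<N)

simsun-complete : ∀ N l → Simsun N l → SimsunTest N l ≡ true
simsun-complete N l h = subst (λ ms → all _ ms ≡ true) (sym (map-applyUpTo (λ x → x) suc N))
  (all-applyUpTo⇐ _ suc N (λ m m<N → false⇒not (h m m<N)))

restrict-insert : ∀ m u M v → m < M → restrict m (u ++ M ∷ v) ≡ restrict m (u ++ v)
restrict-insert m u M v m<M
  rewrite filter-++ (λ x → T? (x ≤ᵇ m)) u (M ∷ v) | filter-++ (λ x → T? (x ≤ᵇ m)) u v
        | ≤ᵇ-false {M} {m} m<M = refl

restrict-all : ∀ m l → all (λ x → x ≤ᵇ m) l ≡ true → restrict m l ≡ l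
restrict-all m [] h = refl
restrict-all m (y ∷ l) h rewrite ∧-l {y ≤ᵇ m} h = cong (y ∷_) (restrict-all m l (∧-r {y ≤ᵇ m} h))

-- a simsun permutation has no double descent itself (take m = n)
simsun-no-dd : ∀ n l → Perm n l → Simsun n l → NoDoubleDescent l
simsun-no-dd zero [] _ _ = refl
simsun-no-dd zero (x ∷ l) p _ with p x (occurs-head x l)
... | 1≤x , x≤0 , _ = ⊥-elim (<-irrefl refl (≤-trans 1≤x x≤0))
simsun-no-dd (suc n) l p s =
  subst NoDoubleDescent (restrict-all (suc n) l (perm-bound (suc n) l p)) (s n ≤-refl)

simsun-insertMax⇒ : ∀ n u v → Perm n (u ++ v) → Simsun (suc n) (u ++ suc n ∷ v) →
  Simsun n (u ++ v) × startsWithDescent v ≡ false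
simsun-insertMax⇒ n u v p s =
    (λ m m<n → trans (cong hasDoubleDescent (sym (restrict-insert (suc m) u (suc n) v (s≤s m<n))))
                     (s m (m<n⇒m<1+n m<n)))
  , insertMax-no-dd⇒ u (suc n) v (all-right _ u v (perm-below n (u ++ v) p))
      (subst NoDoubleDescent (restrict-all (suc n) (u ++ suc n ∷ v) (insert-bound n u v p)) (s n ≤-refl))

simsun-insertMax⇐ : ∀ n u v → Perm n (u ++ v) → Simsun n (u ++ v) → startsWithDescent v ≡ false →
  Simsun (suc n) (u ++ suc n ∷ v)
simsun-insertMax⇐ n u v p s sd m m<n+1 with m ≟ n
... | yes refl = subst NoDoubleDescent (sym (restrict-all (suc n) (u ++ suc n ∷ v) (insert-bound n u v p)))
                   (insertMax-no-dd⇐ u (suc n) v (all-left _ u v (perm-below n (u ++ v) p))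
                                     (simsun-no-dd n (u ++ v) p s) sd)
... | no m≢n = trans (cong hasDoubleDescent (restrict-insert (suc m) u (suc n) v (s≤s m<n))) (s m m<n)
  where m<n = ≤∧≢⇒< (≤-pred m<n+1) m≢n

SimsunPermL : ℕ → List ℕ → Bool
SimsunPermL N l = PermTest N l ∧ SimsunTest N l

simsunPerm-insertMax⇒ : ∀ n u v → SimsunPermL (suc n) (u ++ suc n ∷ v) ≡ true →
  SimsunPermL n (u ++ v) ≡ true × startsWithDescent v ≡ false
simsunPerm-insertMax⇒ n u v h =
  ∧-intro (perm-complete n (u ++ v) p) (simsun-complete n (u ++ v) (proj₁ s)) , proj₂ s
  where
  p = perm-insertMax⇒ n u v (perm-sound (suc n) (u ++ suc n ∷ v) (∧-l h))
  s = simsun-insertMax⇒ n u v p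
        (simsun-sound (suc n) (u ++ suc n ∷ v) (∧-r {PermTest (suc n) (u ++ suc n ∷ v)} h))

simsunPerm-insertMax⇐ : ∀ n u v → SimsunPermL n (u ++ v) ≡ true → startsWithDescent v ≡ false →
  SimsunPermL (suc n) (u ++ suc n ∷ v) ≡ true
simsunPerm-insertMax⇐ n u v h sd = ∧-intro (perm-complete (suc n) (u ++ suc n ∷ v) (perm-insertMax⇐ n u v p))
  (simsun-complete (suc n) (u ++ suc n ∷ v)
    (simsun-insertMax⇐ n u v p (simsun-sound n (u ++ v) (∧-r {PermTest n (u ++ v)} h)) sd))
  where
  p = perm-sound n (u ++ v) (∧-l h)

-- the position of the first occurrence of x in w (the last slot if none)
positionOf : ∀ {n} → ℕ → Vec ℕ (suc n) → Fin (suc n)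
positionOf x (y ∷ []) = zero
positionOf x (y ∷ z ∷ w) = if x ≡ᵇ y then zero else suc (positionOf x (z ∷ w))

positionOf-∷ : ∀ {n} x y (w : Vec ℕ (suc n)) →
  positionOf x (y ∷ w) ≡ (if x ≡ᵇ y then zero else suc (positionOf x w))
positionOf-∷ x y (z ∷ w) = refl

positionOf-insertAt : ∀ {n} (w : Vec ℕ n) i x → occ x (toList w) ≡ 0 → positionOf x (insertAt w i x) ≡ i
positionOf-insertAt [] zero x o = refl
positionOf-insertAt (y ∷ w) zero x o rewrite ≡ᵇ-refl x = refl
positionOf-insertAt (y ∷ w) (suc i) x o rewrite positionOf-∷ x y (insertAt w i x) with x ≡ᵇ y
... | true with () ← o
... | false = cong suc (positionOf-insertAt w i x o)

lookup-positionOf : ∀ {n} (w : Vec ℕ (suc n)) x → Occurs x (toList w) → lookup w (positionOf x w) ≡ x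
lookup-positionOf (y ∷ []) x o with x ≡ᵇ y in eq
... | true = sym (≡ᵇ-sound x y eq)
... | false with () ← o
lookup-positionOf (y ∷ z ∷ w) x o with x ≡ᵇ y in eq
... | true = sym (≡ᵇ-sound x y eq)
... | false = lookup-positionOf (z ∷ w) x o

occ-insertAt : ∀ {n} (w : Vec ℕ n) i x → occ x (toList (insertAt w i x)) ≡ suc (occ x (toList w))
occ-insertAt w zero x rewrite ≡ᵇ-refl x = refl
occ-insertAt (y ∷ w) (suc i) x rewrite occ-insertAt w i x = +-suc _ (occ x (toList w))

-- pigeonhole: a permutation of {1, …, n + 1} contains the letter n + 1,
-- since otherwise its n + 1 letters would be distinct values in {1, …, n}
max-occurs : ∀ n (w : Vec ℕ (suc n)) → isPerm (suc n) w ≡ true → Occurs (suc n) (toList w)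
max-occurs n w h with occ (suc n) (toList w) ≡ᵇ 0 in absent
... | false = refl
... | true = ⊥-elim (<-irrefl refl (≤-trans (≤-reflexive (sym total)) at-most-n))
  where
  l = toList w
  p = perm-sound (suc n) l h
  below : Below (suc n) l
  below = all-intro _ l (λ x o → <ᵇ-complete (≤∧≢⇒< (proj₁ (proj₂ (p x o)))
            (λ { refl → ≡ᵇ-false (occ (suc n) l) 0 o (≡ᵇ-sound (occ (suc n) l) 0 absent) })))
  total : sumBelow (λ v → occ v l) (suc n) ≡ suc n
  total = trans (sum-occ l (suc n) below) (length-toList w)
  -- 0 does not occur and every other value at most once
  at-most-once : ∀ v → occ v l ≤ ind (not (v ≡ᵇ 0))
  at-most-once v with occ v l ≡ᵇ 0 in o
  ... | true = subst (_≤ ind (not (v ≡ᵇ 0))) (sym (≡ᵇ-sound (occ v l) 0 o)) z≤n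
  ... | false with p v o
  ...   | 1≤v , _ , once = subst (_≤ ind (not (v ≡ᵇ 0))) (sym once) (positive v 1≤v)
    where
    positive : ∀ v → 1 ≤ v → 1 ≤ ind (not (v ≡ᵇ 0))
    positive (suc v) _ = ≤-refl
  at-most-n : sumBelow (λ v → occ v l) (suc n) ≤ n
  at-most-n = ≤-trans (sumBelow-mono _ _ (suc n) at-most-once)
                      (≤-reflexive (trans (sumBelow-const 1 n) (*-identityʳ n)))

-- Simsun permutations satisfy the recursion: remove the letter n + 1.

module InsertMaxDescents {n} (w : Vec ℕ n) (i : Fin (suc n)) (p : Perm n (toList w)) where
  u v : List ℕ
  u = prefix w i
  v = suffix w i

  perm-split : Perm n (u ++ v)
  perm-split = subst (Perm n) (sym (prefix-suffix w i)) p

  des-inserted : des (insertAt w i (suc n)) ≡ desAfter nothing u + (ind (nonEmpty v) + desList v)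
  des-inserted = trans (cong desList (insertAt-split w i (suc n)))
    (desList-insertMax (suc n) u v (all-left _ u v (perm-below n (u ++ v) perm-split))
                                   (all-right _ u v (perm-below n (u ++ v) perm-split)))

  des-original : des w ≡ desAfter nothing u + (ind (descentInto (lastOf nothing u) v) + desList v)
  des-original = trans (cong desList (sym (prefix-suffix w i))) (desAfter-++ nothing u v)

  des-keeps : keepsDescents (lastOf nothing u) v ≡ true → des (insertAt w i (suc n)) ≡ des w
  des-keeps kp =
    trans des-inserted (trans (cong (λ m → desAfter nothing u + (m + desList v)) same) (sym des-original))
    where
    -- either v is empty or there is a descent into it
    equal-ind : ∀ e g → (g ≡ true → e ≡ true) → (not e ∨ g) ≡ true → ind e ≡ ind g
    equal-ind false false _ _ = refl
    equal-ind true true _ _ = refl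
    equal-ind false true into _ with () ← into refl
    same = equal-ind (nonEmpty v) (descentInto (lastOf nothing u) v) (descentInto⇒nonEmpty (lastOf nothing u) v)
                     (∧-r {not (startsWithDescent v)} kp)

  des-adds : addsDescent (lastOf nothing u) v ≡ true → des (insertAt w i (suc n)) ≡ suc (des w)
  des-adds ad = begin
    des (insertAt w i (suc n))
      ≡⟨ des-inserted ⟩
    desAfter nothing u + (ind (nonEmpty v) + desList v)
      ≡⟨ cong (λ b → desAfter nothing u + (ind b + desList v)) nonempty ⟩
    desAfter nothing u + suc (desList v)
      ≡⟨ +-suc _ _ ⟩
    suc (desAfter nothing u + (ind false + desList v))
      ≡⟨ cong (λ b → suc (desAfter nothing u + (ind b + desList v))) (sym no-descent) ⟩
    suc (desAfter nothing u + (ind (descentInto (lastOf nothing u) v) + desList v))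
      ≡⟨ cong suc (sym des-original) ⟩
    suc (des w) ∎
    where
    open ≡-Reasoning
    nonempty = ∧-l (∧-r {not (startsWithDescent v)} ad)
    no-descent = not-true (∧-r {nonEmpty v} (∧-r {not (startsWithDescent v)} ad))

module SimsunStep (n k : ℕ) where
  InA : ℕ → Vec ℕ n → Set
  InA j w = (isSimsunPerm n w ≡ true) × (des w ≡ j)

  keepsᵇ addsᵇ forbiddenᵇ : Vec ℕ n → Fin (suc n) → Bool
  keepsᵇ w i = keepsDescents (lastOf nothing (prefix w i)) (suffix w i)
  addsᵇ w i = addsDescent (lastOf nothing (prefix w i)) (suffix w i)
  forbiddenᵇ w i = startsWithDescent (suffix w i)

  keeps adds : Vec ℕ n → Fin (suc n) → Set
  keeps w i = keepsᵇ w i ≡ true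
  adds w i = addsᵇ w i ≡ true

  InA-irrelevant : ∀ j w → Irrelevant (InA j w)
  InA-irrelevant j w = ×-irrelevant true-irrelevant ≡-irrelevant

  perm : ∀ w → isSimsunPerm n w ≡ true → Perm n (toList w)
  perm w ok = perm-sound n (toList w) (∧-l ok)

  count-keeps : ∀ w → isSimsunPerm n w ≡ true → countFin (keepsᵇ w) ≡ suc (des w)
  count-keeps w ok = count-keeping nothing w
    (simsun-no-dd n (toList w) (perm w ok) (simsun-sound n (toList w) (∧-r {isPerm n w} ok)))

  fibre-keeps : ∀ j w → InA j w → Σ (Fin (suc n)) (keeps w) ↔ Fin (suc j)
  fibre-keeps j w (ok , dj) = countFin↔Fin _ ∘↔ Fin-cong (trans (count-keeps w ok) (cong suc dj))

  -- the n + 1 slots are j + 1 keeping, j forbidden and the rest adding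
  fibre-adds : ∀ j w → InA j w → Σ (Fin (suc n)) (adds w) ↔ Fin (n ∸ (j + j))
  fibre-adds j w (ok , dj) = countFin↔Fin _ ∘↔ Fin-cong adding
    where
    K A F : ℕ
    K = countFin (keepsᵇ w)
    A = countFin (addsᵇ w)
    F = countFin (forbiddenᵇ w)
    all-slots : K + A + F ≡ suc n
    all-slots = countFin-partition (keepsᵇ w) (addsᵇ w) (forbiddenᵇ w)
      (λ i → slot-kinds (startsWithDescent (suffix w i)) (nonEmpty (suffix w i))
                        (descentInto (lastOf nothing (prefix w i)) (suffix w i)))
    regroup : ∀ j a → suc j + a + j ≡ suc (a + (j + j))
    regroup = solve-∀
    adding : A ≡ n ∸ (j + j)
    adding = trans (sym (m+n∸n≡m A (j + j))) (cong (_∸ (j + j)) (suc-injective (begin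
      suc (A + (j + j))   ≡⟨ sym (regroup j A) ⟩
      suc j + A + j       ≡⟨ cong₂ (λ a b → a + A + b) (sym (trans (count-keeps w ok) (cong suc dj)))
                                                      (sym (trans (count-forbidden w) dj)) ⟩
      K + A + F           ≡⟨ all-slots ⟩
      suc n ∎)))
      where open ≡-Reasoning

  open StepFromFibres n k InA keeps adds (fibre-keeps k) fibre-adds

  Extends : Vec ℕ n × Fin (suc n) → Set
  Extends (w , i) = (isSimsunPerm (suc n) (insertAt w i (suc n)) ≡ true)
                  × (des (insertAt w i (suc n)) ≡ k)

  insert-ok⇒ : ∀ w i → isSimsunPerm (suc n) (insertAt w i (suc n)) ≡ true →
    isSimsunPerm n w ≡ true × startsWithDescent (suffix w i) ≡ false
  insert-ok⇒ w i ok with simsunPerm-insertMax⇒ n (prefix w i) (suffix w i)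
                          (subst (λ l → SimsunPermL (suc n) l ≡ true) (insertAt-split w i (suc n)) ok)
  ... | ok' , sd = subst (λ l → SimsunPermL n l ≡ true) (prefix-suffix w i) ok' , sd

  insert-ok⇐ : ∀ w i → isSimsunPerm n w ≡ true → startsWithDescent (suffix w i) ≡ false →
    isSimsunPerm (suc n) (insertAt w i (suc n)) ≡ true
  insert-ok⇐ w i ok sd = subst (λ l → SimsunPermL (suc n) l ≡ true) (sym (insertAt-split w i (suc n)))
    (simsunPerm-insertMax⇐ n (prefix w i) (suffix w i)
      (subst (λ l → SimsunPermL n l ≡ true) (sym (prefix-suffix w i)) ok) sd)

  classify : ∀ x → Extends x → Extend₁ x ⊎ Extend₂ x
  classify (w , i) (ok , dk) with insert-ok⇒ w i ok
  ... | okw , sd with slot-allowed (lastOf nothing (prefix w i)) (suffix w i) sd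
  ...   | inj₁ kp = inj₁ ((okw , trans (sym (des-keeps kp)) dk) , kp)
    where open InsertMaxDescents w i (perm w okw)
  ...   | inj₂ ad = inj₂ (AtPred-intro (trans (sym dk) (des-adds ad)) (okw , refl) , ad)
    where open InsertMaxDescents w i (perm w okw)

  from-keeps : ∀ x → Extend₁ x → Extends x
  from-keeps (w , i) ((okw , dk) , kp) =
    insert-ok⇐ w i okw (not-true (∧-l kp)) , trans (des-keeps kp) dk
    where open InsertMaxDescents w i (perm w okw)

  from-adds : ∀ x → Extend₂ x → Extends x
  from-adds (w , i) (below , ad) with AtPred-elim k below
  ... | j , k≡ , (okw , dj) =
    insert-ok⇐ w i okw (not-true (∧-l ad)) , trans (des-adds ad) (trans (cong suc dj) (sym k≡))
    where open InsertMaxDescents w i (perm w okw)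

  remove-max : SimsunWithDescents (suc n) k ↔ Σ (Vec ℕ n × Fin (suc n)) Extends
  remove-max = Σ-transport
    (λ w → removeAt w (position w) , position w) (λ (w , i) → insertAt w i (suc n))
    (λ w p → subst Extends' (sym (reinsert w p)) p) (λ _ q → q)
    reinsert
    (λ (w , i) q → cong₂ _,_ (trans (cong (removeAt (insertAt w i (suc n))) (position-inserted w i q))
                                    (removeAt-insertAt w i (suc n)))
                             (position-inserted w i q))
    (λ _ → ×-irrelevant true-irrelevant ≡-irrelevant) (λ _ → ×-irrelevant true-irrelevant ≡-irrelevant)
    where
    Extends' : Vec ℕ (suc n) → Set
    Extends' w = (isSimsunPerm (suc n) w ≡ true) × (des w ≡ k)
    position : Vec ℕ (suc n) → Fin (suc n)
    position = positionOf (suc n)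
    reinsert : ∀ w → Extends' w → insertAt (removeAt w (position w)) (position w) (suc n) ≡ w
    reinsert w (ok , _) =
      trans (cong (insertAt (removeAt w (position w)) (position w))
                  (sym (lookup-positionOf w (suc n) (max-occurs n w (∧-l ok)))))
            (insertAt-removeAt w (position w))
    -- n + 1 occurs once in the extended word, so not in w
    position-inserted : ∀ w i → Extends (w , i) → position (insertAt w i (suc n)) ≡ i
    position-inserted w i (ok , _) = positionOf-insertAt w i (suc n) (suc-injective (trans
      (sym (occ-insertAt w i (suc n)))
      (proj₂ (proj₂ (perm-sound (suc n) (toList (insertAt w i (suc n))) (∧-l ok) (suc n) max-present)))))
      where
      max-present : Occurs (suc n) (toList (insertAt w i (suc n)))
      max-present rewrite occ-insertAt w i (suc n) = refl

  step : SimsunWithDescents (suc n) k ↔ Step n k (SimsunWithDescents n)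
  step = remove-max
    ∘↔ Σ-split classify from-keeps from-adds
         (λ (w , i) (_ , kp) (_ , ad) → slot-kinds-disjoint (lastOf nothing (prefix w i)) (suffix w i) kp ad)
         (λ _ → ×-irrelevant true-irrelevant ≡-irrelevant)
         (λ (w , _) → ×-irrelevant (InA-irrelevant k w) true-irrelevant)
         (λ (w , _) → ×-irrelevant (AtPred-irrelevant k (λ j → InA-irrelevant j w)) true-irrelevant)
    ∘↔ Step-from-fibres

Simsun-base : ∀ k → SimsunWithDescents 0 k ↔ Code 0 k
Simsun-base zero =
  mk↔ₛ′ (λ _ → tt) (λ _ → [] , refl , refl) (λ _ → refl) (λ { ([] , refl , refl) → refl })
Simsun-base (suc k) = mk↔ₛ′ (λ { ([] , _ , ()) }) (λ ()) (λ ()) (λ { ([] , _ , ()) })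

Simsun↔Code : ∀ n k → SimsunWithDescents n k ↔ Code n k
Simsun↔Code = ↔Code SimsunWithDescents Simsun-base SimsunStep.step

corollary2 : (n k : ℕ) → 1 ≤ n → InvSeq000WithDistinct n k ⤖ SimsunWithDescents n k
corollary2 n k _ = ↔⇒⤖ (InvSeq000↔Code n k ∘↔ ↔-sym (Simsun↔Code n k))
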